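{- Let $p\ge1$, $1\le q\le3$, $i\in\{0,\dots,p-1\}$, and let $F_i\subseteq E$ be a feasible solution to $(p,q-1)$-FGC (i.e., every $\emptyset\ne A\subsetneq V$ has $|\delta_{F_i\cap\mathcal{S}}(A)|\ge p$ or $|\delta_{F_i}(A)|\ge p+q-1$) such that every $\emptyset\ne A\subsetneq V$ with $|\delta_{F_i}(A)|=p+q-1$ has $|\delta_{F_i\cap\mathcal{S}}(A)|\ge i$. Then $\mathcal{C}_i=\{\emptyset\ne A\subsetneq V : |\delta_{F_i}(A)|=p+q-1,\ |\delta_{F_i\cap\mathcal{S}}(A)|=i\}$ is uncrossable.
   Context: $G=(V,E)$ is an undirected (multi)graph whose edges are partitioned into safe edges $\mathcal{S}$ and unsafe edges $\mathcal{U}$; $\delta_F(A)$ denotes the set of edges of $F$ with exactly one endpoint in $A$. A family $\mathcal{C}\subseteq2^V$ is uncrossable if for all $A,B\in\mathcal{C}$, either $A\cup B,A\cap B\in\mathcal{C}$ or $A\setminus B,B\setminus A\in\mathcal{C}$. -}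

module Defs where

open import Data.Nat using (ℕ; _+_; _∸_; _≥_; _≤_; _<_)
open import Data.Bool using (Bool; true; false; if_then_else_; _∧_; _xor_)
open import Data.Fin using (Fin)
open import Data.Fin.Subset using (Subset; Nonempty; ∁; _∩_; _∪_; _─_)
open import Data.Vec using (lookup)
open import Data.List using (List; map; allFin)
open import Data.Nat.ListAction using (sum)
open import Relation.Binary.PropositionalEquality using (_≡_)
open import Data.Product using (_×_)
open import Data.Sum using (_⊎_)

-- A finite multigraph G = (V,E) with V = Fin n and E = Fin m (edges are
-- indices, so parallel edges are allowed). Each edge has two endpoints.
record MultiGraph (n m : ℕ) : Set where
  field
    endpoints : Fin m → Fin n × Fin n

open MultiGraph public

crosses : ∀ {n m} → MultiGraph n m → Subset n → Fin m → Bool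
crosses G A e = lookup A (Data.Product.proj₁ (endpoints G e)) xor lookup A (Data.Product.proj₂ (endpoints G e))

δ : ∀ {n m} → MultiGraph n m → Subset m → Subset n → ℕ
δ G F A = sum (map (λ e → if lookup F e ∧ crosses G A e then 1 else 0) (allFin _))

NonemptyProper : ∀ {n} → Subset n → Set
NonemptyProper A = Nonempty A × Nonempty (∁ A)

Uncrossable : ∀ {n} → (Subset n → Set) → Set
Uncrossable {n} C = ∀ (A B : Subset n) → C A → C B →
  (C (A ∪ B) × C (A ∩ B)) ⊎ (C (A ─ B) × C (B ─ A))

-- F feasible for (p,r)-FGC, with safe edge set S (unsafe edges = complement).
FeasibleFGC : ∀ {n m} → MultiGraph n m → (S F : Subset m) → ℕ → ℕ → Set
FeasibleFGC {n} G S F p r = ∀ (A : Subset n) → NonemptyProper A →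
  (δ G (F ∩ S) A ≥ p) ⊎ (δ G F A ≥ p + r)

Ci : ∀ {n m} → MultiGraph n m → (S F : Subset m) → (p q i : ℕ) → Subset n → Set
Ci G S F p q i A = NonemptyProper A × (δ G F A ≡ p + q ∸ 1) × (δ G (F ∩ S) A ≡ i)

{-# OPTIONS --safe #-}
module Submission where

-- Let A, B ∈ 𝒞ᵢ and k = p + q − 1.  Counting edges by the Venn regions of A and B gives, for F and
-- for F ∩ S alike,
--   |δ(A)| + |δ(B)| = |δ(A ∪ B)| + |δ(A ∩ B)| + 2e₁ = |δ(A ─ B)| + |δ(B ─ A)| + 2e₂,
--   |δ(X)| + |δ(Y)| = |δ(Z)| + 2e_XY   for X ∈ {A ∩ B, A ∪ B}, Y ∈ {A ─ B, B ─ A}, suitable Z ∈ {A, B},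
-- where each e counts the edges between two of the regions.  If both sets of one of the pairs
-- {A ∪ B, A ∩ B}, {A ─ B, B ─ A} have |δ_F| ≥ k, the first line squeezes them to |δ_F| = k and then,
-- by the hypothesis on such sets, to |δ_{F∩S}| = i.  Otherwise some X and Y as above have |δ_F| < k,
-- hence at least p safe edges each by feasibility; the second line then gives 2e_XY ≤ k − 2 ≤ p for F
-- (this is where q ≤ 3 enters) but 2e_XY ≥ 2p − i > p for F ∩ S.  Empty regions are degenerate
-- cases, settled using that 𝒞ᵢ is closed under complement.

open import Defs
open import Data.Nat using (ℕ; _+_; _∸_; _≥_; _≤_; _<_)
open import Data.Fin.Subset using (Subset; _∩_)
open import Relation.Binary.PropositionalEquality using (_≡_)

import Algebra.Lattice.Properties.BooleanAlgebra as BooleanAlgebraProperties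
open import Data.Bool using (Bool; true; false; not; _∧_; _∨_; _xor_; if_then_else_; T)
open import Data.Bool.Properties using (T-∧; ∧-zeroʳ; ∧-identityʳ; not-involutive)
open import Data.Empty using (⊥-elim)
open import Data.Fin using (Fin; zero; suc)
open import Data.Fin.Subset using (Nonempty; ∁; _∪_; _─_; ⊥; _⊆_; inside; outside)
open import Data.Fin.Subset.Properties
  using ( nonempty?; Empty-unique; ∩-comm; ∪-comm; ⊆-trans; p∩q⊆p; p⊆p∪q; q⊆p∪q; p─q⊆p; p⊆q⇒∁p⊇∁q
        ; ∪-∩-booleanAlgebra)
open import Data.List using ([]; _∷_; map; allFin)
open import Data.List.Properties using (map-cong)
open import Data.Nat using (suc; _*_; _≡ᵇ_; z≤n; s≤s; _≤?_)
open import Data.Nat.ListAction using (sum)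
open import Data.Nat.Properties
open import Algebra.Properties.CommutativeSemigroup +-commutativeSemigroup using (interchange)
open import Data.Product using (_×_; _,_; proj₁; proj₂)
open import Data.Sum using (_⊎_; inj₁; inj₂; [_,_]′; map₂)
open import Data.Vec using ([]; _∷_; lookup)
open import Data.Vec.Properties using (lookup-zipWith; lookup-map; lookup-replicate; ∷-injectiveʳ)
open import Function using (id; flip)
open import Function.Bundles using (Equivalence)
open import Relation.Binary.PropositionalEquality
  using (refl; sym; trans; cong; cong₂; subst; module ≡-Reasoning)
open import Relation.Nullary using (¬_; yes; no; contradiction)

sum-map-+ : ∀ {a} {X : Set a} (f g : X → ℕ) xs →
  sum (map (λ x → f x + g x) xs) ≡ sum (map f xs) + sum (map g xs)
sum-map-+ f g []       = refl
sum-map-+ f g (x ∷ xs) =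
  trans (cong (f x + g x +_) (sum-map-+ f g xs)) (interchange (f x) (g x) _ _)

sum-map-* : ∀ {a} {X : Set a} c (f : X → ℕ) xs → sum (map (λ x → c * f x) xs) ≡ c * sum (map f xs)
sum-map-* c f []       = sym (*-zeroʳ c)
sum-map-* c f (x ∷ xs) =
  trans (cong (c * f x +_) (sum-map-* c f xs)) (sym (*-distribˡ-+ c (f x) _))

sum-map-mono : ∀ {a} {X : Set a} {f g : X → ℕ} → (∀ x → f x ≤ g x) →
  ∀ xs → sum (map f xs) ≤ sum (map g xs)
sum-map-mono f≤g []       = z≤n
sum-map-mono f≤g (x ∷ xs) = +-mono-≤ (f≤g x) (sum-map-mono f≤g xs)

sum-map-zero : ∀ {a} {X : Set a} {f : X → ℕ} → (∀ x → f x ≡ 0) → ∀ xs → sum (map f xs) ≡ 0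
sum-map-zero f≡0 []       = refl
sum-map-zero f≡0 (x ∷ xs) = cong₂ _+_ (f≡0 x) (sum-map-zero f≡0 xs)

+-squeeze : ∀ {m x y t} → m ≤ x → m ≤ y → m + m ≡ x + y + t → x ≡ m × y ≡ m
+-squeeze {m} {x} {y} {t} m≤x m≤y m+m≡x+y+t = ≤-antisym x≤m m≤x , ≤-antisym y≤m m≤y
  where
  x+y≤m+m : x + y ≤ m + m
  x+y≤m+m = subst (x + y ≤_) (sym m+m≡x+y+t) (m≤m+n (x + y) t)
  x≤m : x ≤ m
  x≤m = +-cancelʳ-≤ m x m (≤-trans (+-monoʳ-≤ x m≤y) x+y≤m+m)
  y≤m : y ≤ m
  y≤m = +-cancelˡ-≤ m y m (≤-trans (+-monoˡ-≤ y m≤x) x+y≤m+m)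

every : (Bool → Bool) → Bool
every P = P false ∧ P true

every-sound : ∀ P → T (every P) → ∀ b → T (P b)
every-sound P holds false = proj₁ (Equivalence.to (T-∧ {P false}) holds)
every-sound P holds true  = proj₂ (Equivalence.to (T-∧ {P false}) holds)

every⁴ : (Bool → Bool → Bool → Bool → Bool) → Bool
every⁴ P = every λ a₁ → every λ b₁ → every λ a₂ → every (P a₁ b₁ a₂)

every⁴-sound : ∀ P → T (every⁴ P) → ∀ a₁ b₁ a₂ b₂ → T (P a₁ b₁ a₂ b₂)
every⁴-sound P holds a₁ b₁ a₂ =
  every-sound (P a₁ b₁ a₂)
    (every-sound (λ a₂ → every (P a₁ b₁ a₂))
      (every-sound (λ b₁ → every λ a₂ → every (P a₁ b₁ a₂))
        (every-sound (λ a₁ → every λ b₁ → every λ a₂ → every (P a₁ b₁ a₂)) holds a₁) b₁) a₂)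

ind : Bool → ℕ
ind b = if b then 1 else 0

-- δ G W X is definitionally count W (crosses G X).
count : ∀ {m} → Subset m → (Fin m → Bool) → ℕ
count W P = sum (map (λ e → ind (lookup W e ∧ P e)) (allFin _))

∧-preserves-ind-identity : ∀ w {x₁ x₂ y₁ y₂ z} → ind x₁ + ind x₂ ≡ ind y₁ + ind y₂ + 2 * ind z →
  ind (w ∧ x₁) + ind (w ∧ x₂) ≡ ind (w ∧ y₁) + ind (w ∧ y₂) + 2 * ind (w ∧ z)
∧-preserves-ind-identity false _  = refl
∧-preserves-ind-identity true  eq = eq

count-identity : ∀ {m} {P₁ P₂ Q₁ Q₂ R : Fin m → Bool} →
  (∀ e → ind (P₁ e) + ind (P₂ e) ≡ ind (Q₁ e) + ind (Q₂ e) + 2 * ind (R e)) →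
  ∀ W → count W P₁ + count W P₂ ≡ count W Q₁ + count W Q₂ + 2 * count W R
count-identity {m} {P₁} {P₂} {Q₁} {Q₂} {R} per-edge W = begin
  count W P₁ + count W P₂
    ≡⟨ sum-map-+ (in-W P₁) (in-W P₂) es ⟨
  sum (map (λ e → in-W P₁ e + in-W P₂ e) es)
    ≡⟨ cong sum (map-cong (λ e → ∧-preserves-ind-identity (lookup W e) (per-edge e)) es) ⟩
  sum (map (λ e → in-W Q₁ e + in-W Q₂ e + 2 * in-W R e) es)
    ≡⟨ sum-map-+ _ (λ e → 2 * in-W R e) es ⟩
  sum (map (λ e → in-W Q₁ e + in-W Q₂ e) es) + sum (map (λ e → 2 * in-W R e) es)
    ≡⟨ cong₂ _+_ (sum-map-+ (in-W Q₁) (in-W Q₂) es) (sum-map-* 2 (in-W R) es) ⟩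
  count W Q₁ + count W Q₂ + 2 * count W R
    ∎
  where
  open ≡-Reasoning
  es = allFin m
  in-W : (Fin m → Bool) → Fin m → ℕ
  in-W P e = ind (lookup W e ∧ P e)

ind-∧-≤ : ∀ w s x → ind ((w ∧ s) ∧ x) ≤ ind (w ∧ x)
ind-∧-≤ false s     x = z≤n
ind-∧-≤ true  true  x = ≤-refl
ind-∧-≤ true  false x = z≤n

count-∩-≤ : ∀ {m} (W S : Subset m) P → count (W ∩ S) P ≤ count W P
count-∩-≤ W S P = sum-map-mono per-edge (allFin _)
  where
  per-edge : ∀ e → ind (lookup (W ∩ S) e ∧ P e) ≤ ind (lookup W e ∧ P e)
  per-edge e = subst (λ b → ind (b ∧ P e) ≤ ind (lookup W e ∧ P e))
                     (sym (lookup-zipWith _∧_ e W S)) (ind-∧-≤ (lookup W e) (lookup S e) (P e))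

not-xor-not : ∀ a b → not a xor not b ≡ a xor b
not-xor-not true  b = refl
not-xor-not false b = not-involutive b

crosses-∁ : ∀ {n m} (G : MultiGraph n m) X e → crosses G (∁ X) e ≡ crosses G X e
crosses-∁ G X e =
  trans (cong₂ _xor_ (lookup-map u not X) (lookup-map v not X)) (not-xor-not (lookup X u) (lookup X v))
  where
  u = proj₁ (endpoints G e)
  v = proj₂ (endpoints G e)

δ-∁ : ∀ {n m} (G : MultiGraph n m) W X → δ G W (∁ X) ≡ δ G W X
δ-∁ G W X = cong sum (map-cong (λ e → cong (λ c → ind (lookup W e ∧ c)) (crosses-∁ G X e)) (allFin _))

δ-⊥ : ∀ {n m} (G : MultiGraph n m) W → δ G W ⊥ ≡ 0
δ-⊥ {n} G W = sum-map-zero per-edge (allFin _)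
  where
  per-edge : ∀ e → ind (lookup W e ∧ crosses G ⊥ e) ≡ 0
  per-edge e = cong ind (trans
    (cong₂ (λ a b → lookup W e ∧ (a xor b)) (lookup-replicate {n = n} (proj₁ (endpoints G e)) false)
                                           (lookup-replicate {n = n} (proj₂ (endpoints G e)) false))
    (∧-zeroʳ (lookup W e)))

lookup-─ : ∀ {n} (p q : Subset n) i → lookup (p ─ q) i ≡ lookup p i ∧ not (lookup q i)
lookup-─ (x ∷ p) (inside  ∷ q) zero    = sym (∧-zeroʳ x)
lookup-─ (x ∷ p) (outside ∷ q) zero    = sym (∧-identityʳ x)
lookup-─ (_ ∷ p) (_       ∷ q) (suc i) = lookup-─ p q i

∁-involutive : ∀ {n} (p : Subset n) → ∁ (∁ p) ≡ p
∁-involutive {n} = BooleanAlgebraProperties.¬-involutive (∪-∩-booleanAlgebra n)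

p∩q≡⊥⇒p─q≡p : ∀ {n} (p q : Subset n) → p ∩ q ≡ ⊥ → p ─ q ≡ p
p∩q≡⊥⇒p─q≡p []            []            _  = refl
p∩q≡⊥⇒p─q≡p (x       ∷ p) (outside ∷ q) eq =
  cong (x ∷_) (p∩q≡⊥⇒p─q≡p p q (∷-injectiveʳ eq))
p∩q≡⊥⇒p─q≡p (outside ∷ p) (inside  ∷ q) eq =
  cong (outside ∷_) (p∩q≡⊥⇒p─q≡p p q (∷-injectiveʳ eq))
p∩q≡⊥⇒p─q≡p (inside  ∷ p) (inside  ∷ q) ()

∁[p∪q]≡⊥⇒p─q≡∁q : ∀ {n} (p q : Subset n) → ∁ (p ∪ q) ≡ ⊥ → p ─ q ≡ ∁ q
∁[p∪q]≡⊥⇒p─q≡∁q []            []            _  = refl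
∁[p∪q]≡⊥⇒p─q≡∁q (x       ∷ p) (inside  ∷ q) eq =
  cong (outside ∷_) (∁[p∪q]≡⊥⇒p─q≡∁q p q (∷-injectiveʳ eq))
∁[p∪q]≡⊥⇒p─q≡∁q (inside  ∷ p) (outside ∷ q) eq =
  cong (inside ∷_) (∁[p∪q]≡⊥⇒p─q≡∁q p q (∷-injectiveʳ eq))
∁[p∪q]≡⊥⇒p─q≡∁q (outside ∷ p) (outside ∷ q) ()

p─q≡⊥⇒p∩q≡p : ∀ {n} (p q : Subset n) → p ─ q ≡ ⊥ → p ∩ q ≡ p
p─q≡⊥⇒p∩q≡p []            []            _  = refl
p─q≡⊥⇒p∩q≡p (outside ∷ p) (y       ∷ q) eq =
  cong (outside ∷_) (p─q≡⊥⇒p∩q≡p p q (∷-injectiveʳ eq))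
p─q≡⊥⇒p∩q≡p (inside  ∷ p) (inside  ∷ q) eq =
  cong (inside ∷_) (p─q≡⊥⇒p∩q≡p p q (∷-injectiveʳ eq))
p─q≡⊥⇒p∩q≡p (inside  ∷ p) (outside ∷ q) ()

p─q≡⊥⇒p∪q≡q : ∀ {n} (p q : Subset n) → p ─ q ≡ ⊥ → p ∪ q ≡ q
p─q≡⊥⇒p∪q≡q []            []            _  = refl
p─q≡⊥⇒p∪q≡q (outside ∷ p) (y       ∷ q) eq =
  cong (y ∷_) (p─q≡⊥⇒p∪q≡q p q (∷-injectiveʳ eq))
p─q≡⊥⇒p∪q≡q (inside  ∷ p) (inside  ∷ q) eq =
  cong (inside ∷_) (p─q≡⊥⇒p∪q≡q p q (∷-injectiveʳ eq))
p─q≡⊥⇒p∪q≡q (inside  ∷ p) (outside ∷ q) ()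

Nonempty-⊆ : ∀ {n} {p q : Subset n} → p ⊆ q → Nonempty p → Nonempty q
Nonempty-⊆ p⊆q (x , x∈p) = x , p⊆q x∈p

venn-nonemptyProper : ∀ {n} {A B : Subset n} →
  Nonempty (A ∩ B) → Nonempty (∁ (A ∪ B)) → Nonempty (A ─ B) → Nonempty (B ─ A) →
  NonemptyProper (A ∪ B) × NonemptyProper (A ∩ B) × NonemptyProper (A ─ B) × NonemptyProper (B ─ A)
venn-nonemptyProper {A = A} {B} ne[A∩B] ne[∁A∪B] ne[A─B] ne[B─A] =
  (Nonempty-⊆ (⊆-trans (p∩q⊆p A B) (p⊆p∪q B)) ne[A∩B] , ne[∁A∪B]) ,
  (ne[A∩B] , Nonempty-⊆ (⊆-trans ∁[A∪B]⊆∁A (p⊆q⇒∁p⊇∁q (p∩q⊆p A B))) ne[∁A∪B]) ,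
  (ne[A─B] , Nonempty-⊆ (⊆-trans ∁[A∪B]⊆∁A (p⊆q⇒∁p⊇∁q (p─q⊆p A B))) ne[∁A∪B]) ,
  (ne[B─A] , Nonempty-⊆ (⊆-trans ∁[A∪B]⊆∁B (p⊆q⇒∁p⊇∁q (p─q⊆p B A))) ne[∁A∪B])
  where
  ∁[A∪B]⊆∁A : ∁ (A ∪ B) ⊆ ∁ A
  ∁[A∪B]⊆∁A = p⊆q⇒∁p⊇∁q (p⊆p∪q B)
  ∁[A∪B]⊆∁B : ∁ (A ∪ B) ⊆ ∁ B
  ∁[A∪B]⊆∁B = p⊆q⇒∁p⊇∁q (q⊆p∪q A B)

-- A predicate on the memberships a₁, b₁ (in A, B) of an edge's first endpoint and a₂, b₂ of its second.
EdgeType : Set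
EdgeType = Bool → Bool → Bool → Bool → Bool

crossing : (Bool → Bool → Bool) → EdgeType
crossing g a₁ b₁ a₂ b₂ = g a₁ b₁ xor g a₂ b₂

joining : (Bool → Bool → Bool) → (Bool → Bool → Bool) → EdgeType
joining g h a₁ b₁ a₂ b₂ = (g a₁ b₁ ∧ h a₂ b₂) ∨ (h a₁ b₁ ∧ g a₂ b₂)

balance : (g₁ g₂ h₁ h₂ : Bool → Bool → Bool) → EdgeType → Bool → Bool → Bool → Bool → Bool
balance g₁ g₂ h₁ h₂ τ a₁ b₁ a₂ b₂ =
  ind (crossing g₁ a₁ b₁ a₂ b₂) + ind (crossing g₂ a₁ b₁ a₂ b₂)
    ≡ᵇ ind (crossing h₁ a₁ b₁ a₂ b₂) + ind (crossing h₂ a₁ b₁ a₂ b₂) + 2 * ind (τ a₁ b₁ a₂ b₂)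

-- For concrete arguments this computes to ⊤ or ⊥, so the identities below are proved by evaluation.
Balanced : (g₁ g₂ h₁ h₂ : Bool → Bool → Bool) → EdgeType → Set
Balanced g₁ g₂ h₁ h₂ τ = T (every⁴ (balance g₁ g₂ h₁ h₂ τ))

_∖_ : Bool → Bool → Bool
a ∖ b = a ∧ not b

neither : Bool → Bool → Bool
neither a b = not (a ∨ b)

module VennCounting {n m} (G : MultiGraph n m) (A B : Subset n) where

  -- A record rather than a function, so that X and g can be inferred from a proof of X ≐ g.
  record _≐_ (X : Subset n) (g : Bool → Bool → Bool) : Set where
    constructor pointwise
    field lookup-≐ : ∀ v → lookup X v ≡ g (lookup A v) (lookup B v)
  open _≐_

  _at_ : EdgeType → Fin m → Bool
  τ at e = τ (lookup A u) (lookup B u) (lookup A v) (lookup B v)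
    where
    u = proj₁ (endpoints G e)
    v = proj₂ (endpoints G e)

  crosses-≐ : ∀ {X g} → X ≐ g → ∀ e → crosses G X e ≡ crossing g at e
  crosses-≐ X≐g e = cong₂ _xor_ (lookup-≐ X≐g _) (lookup-≐ X≐g _)

  δ-identity : ∀ {X₁ X₂ Y₁ Y₂ g₁ g₂ h₁ h₂} → X₁ ≐ g₁ → X₂ ≐ g₂ → Y₁ ≐ h₁ → Y₂ ≐ h₂ →
    (τ : EdgeType) → Balanced g₁ g₂ h₁ h₂ τ →
    ∀ W → δ G W X₁ + δ G W X₂ ≡ δ G W Y₁ + δ G W Y₂ + 2 * count W (τ at_)
  δ-identity {X₁} {X₂} {Y₁} {Y₂} {g₁} {g₂} {h₁} {h₂} X₁≐ X₂≐ Y₁≐ Y₂≐ τ balanced =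
    count-identity {P₁ = crosses G X₁} {crosses G X₂} {crosses G Y₁} {crosses G Y₂} per-edge
    where
    open ≡-Reasoning
    per-edge : ∀ e → ind (crosses G X₁ e) + ind (crosses G X₂ e)
                     ≡ ind (crosses G Y₁ e) + ind (crosses G Y₂ e) + 2 * ind (τ at e)
    per-edge e = begin
      ind (crosses G X₁ e) + ind (crosses G X₂ e)
        ≡⟨ cong₂ (λ c d → ind c + ind d) (crosses-≐ X₁≐ e) (crosses-≐ X₂≐ e) ⟩
      ind (crossing g₁ at e) + ind (crossing g₂ at e)
        ≡⟨ ≡ᵇ⇒≡ _ _ (every⁴-sound (balance g₁ g₂ h₁ h₂ τ) balanced _ _ _ _) ⟩
      ind (crossing h₁ at e) + ind (crossing h₂ at e) + 2 * ind (τ at e)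
        ≡⟨ cong₂ (λ c d → ind c + ind d + 2 * ind (τ at e)) (crosses-≐ Y₁≐ e) (crosses-≐ Y₂≐ e) ⟨
      ind (crosses G Y₁ e) + ind (crosses G Y₂ e) + 2 * ind (τ at e) ∎

  ⊥≐ : ⊥ ≐ λ _ _ → false
  ⊥≐ = pointwise λ v → lookup-replicate v false

  δ-identity₁ : ∀ {X₁ X₂ Y g₁ g₂ h} → X₁ ≐ g₁ → X₂ ≐ g₂ → Y ≐ h →
    (τ : EdgeType) → Balanced g₁ g₂ h (λ _ _ → false) τ →
    ∀ W → δ G W X₁ + δ G W X₂ ≡ δ G W Y + 2 * count W (τ at_)
  δ-identity₁ {X₁} {X₂} {Y} X₁≐ X₂≐ Y≐ τ balanced W = begin
    δ G W X₁ + δ G W X₂                 ≡⟨ δ-identity X₁≐ X₂≐ Y≐ ⊥≐ τ balanced W ⟩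
    δ G W Y + δ G W ⊥ + 2 * c           ≡⟨ cong (λ z → δ G W Y + z + 2 * c) (δ-⊥ G W) ⟩
    δ G W Y + 0 + 2 * c                 ≡⟨ cong (_+ 2 * c) (+-identityʳ (δ G W Y)) ⟩
    δ G W Y + 2 * c                     ∎
    where
    open ≡-Reasoning
    c = count W (τ at_)

  between : (Bool → Bool → Bool) → (Bool → Bool → Bool) → Subset m → ℕ
  between g h W = count W (joining g h at_)

  A≐ : A ≐ λ a _ → a
  A≐ = pointwise λ _ → refl

  B≐ : B ≐ λ _ b → b
  B≐ = pointwise λ _ → refl

  A∩B≐ : (A ∩ B) ≐ _∧_
  A∩B≐ = pointwise λ v → lookup-zipWith _∧_ v A B

  A∪B≐ : (A ∪ B) ≐ _∨_
  A∪B≐ = pointwise λ v → lookup-zipWith _∨_ v A B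

  A─B≐ : (A ─ B) ≐ _∖_
  A─B≐ = pointwise (lookup-─ A B)

  B─A≐ : (B ─ A) ≐ flip _∖_
  B─A≐ = pointwise (lookup-─ B A)

  δ-submodular : ∀ W → δ G W A + δ G W B
                       ≡ δ G W (A ∪ B) + δ G W (A ∩ B) + 2 * between _∖_ (flip _∖_) W
  δ-submodular = δ-identity A≐ B≐ A∪B≐ A∩B≐ (joining _∖_ (flip _∖_)) _

  δ-posimodular : ∀ W → δ G W A + δ G W B
                        ≡ δ G W (A ─ B) + δ G W (B ─ A) + 2 * between _∧_ neither W
  δ-posimodular = δ-identity A≐ B≐ A─B≐ B─A≐ (joining _∧_ neither) _

  δ[A∩B]+δ[A─B] : ∀ W → δ G W (A ∩ B) + δ G W (A ─ B) ≡ δ G W A + 2 * between _∧_ _∖_ W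
  δ[A∩B]+δ[A─B] = δ-identity₁ A∩B≐ A─B≐ A≐ (joining _∧_ _∖_) _

  δ[A∩B]+δ[B─A] : ∀ W → δ G W (A ∩ B) + δ G W (B ─ A) ≡ δ G W B + 2 * between _∧_ (flip _∖_) W
  δ[A∩B]+δ[B─A] = δ-identity₁ A∩B≐ B─A≐ B≐ (joining _∧_ (flip _∖_)) _

  δ[A∪B]+δ[A─B] : ∀ W → δ G W (A ∪ B) + δ G W (A ─ B) ≡ δ G W B + 2 * between _∖_ neither W
  δ[A∪B]+δ[A─B] = δ-identity₁ A∪B≐ A─B≐ B≐ (joining _∖_ neither) _

  δ[A∪B]+δ[B─A] : ∀ W → δ G W (A ∪ B) + δ G W (B ─ A) ≡ δ G W A + 2 * between (flip _∖_) neither W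
  δ[A∪B]+δ[B─A] = δ-identity₁ A∪B≐ B─A≐ A≐ (joining (flip _∖_) neither) _

module Uncrossing {n m} (G : MultiGraph n m) (S F : Subset m) {p k i : ℕ}
  (i<p : i < p) (k≤p+2 : k ≤ p + 2)
  (feasible : ∀ X → NonemptyProper X → p ≤ δ G (F ∩ S) X ⊎ k ≤ δ G F X)
  (tight⇒safe : ∀ X → NonemptyProper X → δ G F X ≡ k → i ≤ δ G (F ∩ S) X) where

  -- 𝒞 is 𝒞ᵢ for k = p + q − 1.
  𝒞 : Subset n → Set
  𝒞 X = NonemptyProper X × δ G F X ≡ k × δ G (F ∩ S) X ≡ i

  𝒞-∁ : ∀ {X} → 𝒞 X → 𝒞 (∁ X)
  𝒞-∁ {X} ((neX , ne∁X) , dX≡k , sX≡i) =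
    (ne∁X , subst Nonempty (sym (∁-involutive X)) neX) ,
    trans (δ-∁ G F X) dX≡k , trans (δ-∁ G (F ∩ S) X) sX≡i

  deficient⇒safe : ∀ {X} → NonemptyProper X → δ G F X < k → p ≤ δ G (F ∩ S) X
  deficient⇒safe {X} npX dX<k = [ id , (λ k≤dX → contradiction k≤dX (<⇒≱ dX<k)) ]′ (feasible X npX)

  𝒞-pair : ∀ {A B X Y} {t : Subset m → ℕ} → 𝒞 A → 𝒞 B → NonemptyProper X → NonemptyProper Y →
    k ≤ δ G F X → k ≤ δ G F Y → (∀ W → δ G W A + δ G W B ≡ δ G W X + δ G W Y + 2 * t W) → 𝒞 X × 𝒞 Y
  𝒞-pair {X = X} {Y} (_ , dA≡k , sA≡i) (_ , dB≡k , sB≡i) npX npY k≤dX k≤dY identity =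
    let (dX≡k , dY≡k) = +-squeeze k≤dX k≤dY (trans (cong₂ _+_ (sym dA≡k) (sym dB≡k)) (identity F))
        (sX≡i , sY≡i) = +-squeeze (tight⇒safe X npX dX≡k) (tight⇒safe Y npY dY≡k)
                          (trans (cong₂ _+_ (sym sA≡i) (sym sB≡i)) (identity (F ∩ S)))
    in (npX , dX≡k , sX≡i) , (npY , dY≡k , sY≡i)

  ¬deficient-pair : ∀ {Z X Y} {t : Subset m → ℕ} → 𝒞 Z → NonemptyProper X → NonemptyProper Y →
    (∀ W → δ G W X + δ G W Y ≡ δ G W Z + 2 * t W) → t (F ∩ S) ≤ t F →
    δ G F X < k → ¬ δ G F Y < k
  ¬deficient-pair {Z} {X} {Y} {t} (_ , dZ≡k , sZ≡i) npX npY identity t-mono dX<k dY<k =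
    <-irrefl refl (begin-strict
      p + p                           ≤⟨ +-mono-≤ (deficient⇒safe npX dX<k) (deficient⇒safe npY dY<k) ⟩
      δ G (F ∩ S) X + δ G (F ∩ S) Y   ≡⟨ identity (F ∩ S) ⟩
      δ G (F ∩ S) Z + 2 * t (F ∩ S)   ≡⟨ cong (_+ 2 * t (F ∩ S)) sZ≡i ⟩
      i + 2 * t (F ∩ S)               ≤⟨ +-monoʳ-≤ i (*-monoʳ-≤ 2 t-mono) ⟩
      i + 2 * t F                     ≤⟨ +-monoʳ-≤ i 2t≤p ⟩
      i + p                           <⟨ +-monoˡ-< p i<p ⟩
      p + p                           ∎)
    where
    open ≤-Reasoning
    2t+2≤k : 2 * t F + 2 ≤ k
    2t+2≤k = +-cancelˡ-≤ k _ _ (begin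
      k + (2 * t F + 2)               ≡⟨ +-assoc k (2 * t F) 2 ⟨
      k + 2 * t F + 2                 ≡⟨ cong (λ z → z + 2 * t F + 2) dZ≡k ⟨
      δ G F Z + 2 * t F + 2           ≡⟨ cong (_+ 2) (identity F) ⟨
      δ G F X + δ G F Y + 2           ≡⟨ trans (+-comm _ 2) (cong suc (sym (+-suc _ _))) ⟩
      suc (δ G F X) + suc (δ G F Y)   ≤⟨ +-mono-≤ dX<k dY<k ⟩
      k + k                           ∎)
    2t≤p : 2 * t F ≤ p
    2t≤p = +-cancelʳ-≤ 2 _ _ (≤-trans 2t+2≤k k≤p+2)

  module _ {A B : Subset n} (A∈𝒞 : 𝒞 A) (B∈𝒞 : 𝒞 B) where
    open VennCounting G A B

    uncross-proper : NonemptyProper (A ∪ B) → NonemptyProper (A ∩ B) →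
      NonemptyProper (A ─ B) → NonemptyProper (B ─ A) →
      (𝒞 (A ∪ B) × 𝒞 (A ∩ B)) ⊎ (𝒞 (A ─ B) × 𝒞 (B ─ A))
    uncross-proper np∪ np∩ np─ np─′
      with k ≤? δ G F (A ∪ B) | k ≤? δ G F (A ∩ B) | k ≤? δ G F (A ─ B) | k ≤? δ G F (B ─ A)
    ... | yes k≤d∪ | yes k≤d∩ | _ | _ =
      inj₁ (𝒞-pair {t = between _∖_ (flip _∖_)} A∈𝒞 B∈𝒞 np∪ np∩ k≤d∪ k≤d∩ δ-submodular)
    ... | _ | _ | yes k≤d─ | yes k≤d─′ =
      inj₂ (𝒞-pair {t = between _∧_ neither} A∈𝒞 B∈𝒞 np─ np─′ k≤d─ k≤d─′ δ-posimodular)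
    ... | _ | no k≰d∩ | no k≰d─ | _ =
      ⊥-elim (¬deficient-pair {t = between _∧_ _∖_} A∈𝒞 np∩ np─
                δ[A∩B]+δ[A─B] (count-∩-≤ F S _) (≰⇒> k≰d∩) (≰⇒> k≰d─))
    ... | _ | no k≰d∩ | _ | no k≰d─′ =
      ⊥-elim (¬deficient-pair {t = between _∧_ (flip _∖_)} B∈𝒞 np∩ np─′
                δ[A∩B]+δ[B─A] (count-∩-≤ F S _) (≰⇒> k≰d∩) (≰⇒> k≰d─′))
    ... | no k≰d∪ | _ | no k≰d─ | _ =
      ⊥-elim (¬deficient-pair {t = between _∖_ neither} B∈𝒞 np∪ np─
                δ[A∪B]+δ[A─B] (count-∩-≤ F S _) (≰⇒> k≰d∪) (≰⇒> k≰d─))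
    ... | no k≰d∪ | _ | _ | no k≰d─′ =
      ⊥-elim (¬deficient-pair {t = between (flip _∖_) neither} A∈𝒞 np∪ np─′
                δ[A∪B]+δ[B─A] (count-∩-≤ F S _) (≰⇒> k≰d∪) (≰⇒> k≰d─′))

  -- When a Venn region is empty, the required pair is {B, A} or {∁ B, ∁ A} itself.
  uncrossable : Uncrossable 𝒞
  uncrossable A B A∈𝒞 B∈𝒞
    with nonempty? (A ∩ B) | nonempty? (∁ (A ∪ B)) | nonempty? (A ─ B) | nonempty? (B ─ A)
  ... | no A∩B=∅ | _ | _ | _ =
    inj₂ (subst 𝒞 (sym (p∩q≡⊥⇒p─q≡p A B (Empty-unique A∩B=∅))) A∈𝒞 ,
          subst 𝒞 (sym (p∩q≡⊥⇒p─q≡p B A (trans (∩-comm B A) (Empty-unique A∩B=∅)))) B∈𝒞)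
  ... | yes _ | no ∁[A∪B]=∅ | _ | _ =
    inj₂ (subst 𝒞 (sym (∁[p∪q]≡⊥⇒p─q≡∁q A B (Empty-unique ∁[A∪B]=∅))) (𝒞-∁ B∈𝒞) ,
          subst 𝒞 (sym (∁[p∪q]≡⊥⇒p─q≡∁q B A (trans (cong ∁ (∪-comm B A)) (Empty-unique ∁[A∪B]=∅))))
                (𝒞-∁ A∈𝒞))
  ... | yes _ | yes _ | no A─B=∅ | _ =
    inj₁ (subst 𝒞 (sym (p─q≡⊥⇒p∪q≡q A B (Empty-unique A─B=∅))) B∈𝒞 ,
          subst 𝒞 (sym (p─q≡⊥⇒p∩q≡p A B (Empty-unique A─B=∅))) A∈𝒞)
  ... | yes _ | yes _ | yes _ | no B─A=∅ =
    inj₁ (subst 𝒞 (sym (trans (∪-comm A B) (p─q≡⊥⇒p∪q≡q B A (Empty-unique B─A=∅)))) A∈𝒞 ,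
          subst 𝒞 (sym (trans (∩-comm A B) (p─q≡⊥⇒p∩q≡p B A (Empty-unique B─A=∅)))) B∈𝒞)
  ... | yes ne∩ | yes ne∁∪ | yes ne─ | yes ne─′ =
    let (np∪ , np∩ , np─ , np─′) = venn-nonemptyProper ne∩ ne∁∪ ne─ ne─′
    in uncross-proper A∈𝒞 B∈𝒞 np∪ np∩ np─ np─′

-- The hypothesis 1 ≤ p is implied by i < p.
lemma3p5 : ∀ {n m} (G : MultiGraph n m) (S : Subset m) (p q i : ℕ) (F : Subset m) →
    1 ≤ p → 1 ≤ q → q ≤ 3 → i < p →
    FeasibleFGC G S F p (q ∸ 1) →
    (∀ (A : Subset n) → NonemptyProper A → δ G F A ≡ p + q ∸ 1 → δ G (F ∩ S) A ≥ i) →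
    Uncrossable (Ci G S F p q i)
lemma3p5 G S p q i F _ 1≤q q≤3 i<p feasible tight⇒safe =
  Uncrossing.uncrossable G S F i<p k≤p+2 feasible′ tight⇒safe
  where
  k≤p+2 : p + q ∸ 1 ≤ p + 2
  k≤p+2 = ≤-trans (∸-monoˡ-≤ 1 (+-monoʳ-≤ p q≤3)) (≤-reflexive (+-∸-assoc p {3} {1} (s≤s z≤n)))
  feasible′ : ∀ X → NonemptyProper X → p ≤ δ G (F ∩ S) X ⊎ p + q ∸ 1 ≤ δ G F X
  feasible′ X npX = map₂ (≤-trans (≤-reflexive (+-∸-assoc p 1≤q))) (feasible X npX)
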